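{- Every vertex-transitive map with Schläfli type $\{7,3\}$ is either regular or chiral.
   Context: A map is a 2-cell embedding of a finite multigraph on a closed surface without boundary; faces are the components of the complement of the graph. Flags are the triangles of the induced triangulation with vertices a vertex, the midpoint of an incident edge and the centre of a face incident to that edge; two flags are adjacent if they share two of these three points. An automorphism is a graph automorphism extending to a homeomorphism of the surface; $\Gamma(M)$ is the automorphism group. $M$ is vertex-transitive if $\Gamma(M)$ is transitive on vertices. $M$ has Schläfli type $\{p,q\}$ if every face has $p$ edges and every vertex has degree $q$. $M$ is regular if $\Gamma(M)$ is transitive on flags, and chiral if $\Gamma(M)$ has exactly two orbits on flags and any two adjacent flags lie in distinct orbits. -}

module Defs where

open import Data.Nat using (ℕ; zero; suc; _<_)
open import Data.Fin using (Fin)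
open import Data.List using (List; []; _∷_)
open import Data.Product using (Σ; ∃; _×_; _,_)
open import Data.Sum using (_⊎_)
open import Relation.Binary.PropositionalEquality using (_≡_; _≢_)
open import Relation.Nullary using (¬_)

iter : {A : Set} → (A → A) → ℕ → A → A
iter f zero    x = x
iter f (suc k) x = f (iter f k x)

ExactPeriod : {A : Set} → (A → A) → ℕ → A → Set
ExactPeriod f k x = (0 < k) × (iter f k x ≡ x) × (∀ j → 0 < j → j < k → iter f j x ≢ x)

actWord : {A : Set} → (A → A) → (A → A) → (A → A) → List (Fin 3) → A → A
actWord f g h []                                x = x
actWord f g h (Fin.zero ∷ w)                    x = f (actWord f g h w x)
actWord f g h (Fin.suc Fin.zero ∷ w)            x = g (actWord f g h w x)
actWord f g h (Fin.suc (Fin.suc Fin.zero) ∷ w)  x = h (actWord f g h w x)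

-- A finite map, encoded combinatorially by its flags (Fin n) and the three
-- flag-adjacency involutions r0 (change vertex), r1 (change edge), r2 (change face).
record Map (n : ℕ) : Set where
  field
    r0 r1 r2 : Fin n → Fin n
    r0-inv : ∀ x → r0 (r0 x) ≡ x
    r1-inv : ∀ x → r1 (r1 x) ≡ x
    r2-inv : ∀ x → r2 (r2 x) ≡ x
    r0-fpf : ∀ x → r0 x ≢ x
    r1-fpf : ∀ x → r1 x ≢ x
    r2-fpf : ∀ x → r2 x ≢ x
    r0r2-comm : ∀ x → r0 (r2 x) ≡ r2 (r0 x)
    r0r2-fpf  : ∀ x → r0 (r2 x) ≢ x

    -- connectedness (the underlying surface/graph is connected): the
    -- monodromy group ⟨r0, r1, r2⟩ is transitive on flags
    connected : ∀ x y → ∃ λ (w : List (Fin 3)) → actWord r0 r1 r2 w x ≡ y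

open Map public

actV : {n : ℕ} → Map n → List (Fin 2) → Fin n → Fin n
actV M []                      x = x
actV M (Fin.zero ∷ w)          x = r1 M (actV M w x)
actV M (Fin.suc Fin.zero ∷ w)  x = r2 M (actV M w x)

-- two flags lie at the same vertex (same orbit of ⟨r1, r2⟩)
SameVertex : {n : ℕ} → Map n → Fin n → Fin n → Set
SameVertex M x y = ∃ λ w → actV M w x ≡ y

-- Schläfli type {p,q}: every face has p edges (the rotation r0 r1 of the
-- face has exact period p on each flag) and every vertex has degree q
-- (the rotation r1 r2 around the vertex has exact period q on each flag).
SchlafliType : {n : ℕ} → Map n → ℕ → ℕ → Set
SchlafliType M p q =
  (∀ x → ExactPeriod (λ y → r0 M (r1 M y)) p x) ×
  (∀ x → ExactPeriod (λ y → r1 M (r2 M y)) q x)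

record Aut {n : ℕ} (M : Map n) : Set where
  field
    σ σ⁻¹ : Fin n → Fin n
    left  : ∀ x → σ⁻¹ (σ x) ≡ x
    right : ∀ x → σ (σ⁻¹ x) ≡ x
    comm0 : ∀ x → σ (r0 M x) ≡ r0 M (σ x)
    comm1 : ∀ x → σ (r1 M x) ≡ r1 M (σ x)
    comm2 : ∀ x → σ (r2 M x) ≡ r2 M (σ x)

open Aut public

SameOrbit : {n : ℕ} → Map n → Fin n → Fin n → Set
SameOrbit M x y = ∃ λ (α : Aut M) → σ α x ≡ y

VertexTransitive : {n : ℕ} → Map n → Set
VertexTransitive M = ∀ x y → ∃ λ (α : Aut M) → SameVertex M (σ α x) y

Regular : {n : ℕ} → Map n → Set
Regular M = ∀ x y → SameOrbit M x y

Chiral : {n : ℕ} → Map n → Set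
Chiral M =
  (Σ (Fin _) λ x → Σ (Fin _) λ y →
     ¬ SameOrbit M x y × (∀ z → SameOrbit M x z ⊎ SameOrbit M y z)) ×
  (∀ x → ¬ SameOrbit M x (r0 M x) × ¬ SameOrbit M x (r1 M x) × ¬ SameOrbit M x (r2 M x))

{-# OPTIONS --safe #-}
-- By vertex-transitivity the six flags at one vertex meet every flag orbit, so two of
-- the seven flags around a face are automorphic: x ~ (r0 r1)ᵈ x with 1 ≤ d ≤ 6. As 7 is
-- prime, some multiple of d is ±1 mod 7, whence x ~ r0 r1 x for every flag, i.e.
-- r1 x ~ r0 x. Then r1 r2 x ~ r0 r2 x = r2 r0 x ~ r2 r1 x, so (r1 r2)² ~ id, and with
-- (r1 r2)³ = id also r1 r2 ~ id and r2 x ~ r0 x. Every flag is therefore in the orbit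
-- of x₀ or of r0 x₀: the two orbits coincide (regular) or adjacent flags always lie in
-- different orbits (chiral).
module Submission where

open import Level using (0ℓ)
open import Defs
open import Data.Nat using (ℕ; zero; suc; _+_; _*_; _≤_; _<_)
open import Data.Nat.Properties
  using (+-comm; +-suc; ≤-refl; ≤-trans; ≤-<-trans; ≤-reflexive; <⇒≤; m≤n+m; m≤n⇒∃[o]m+o≡n)
open import Data.Nat.Primality using (Prime; prime?)
open import Data.Nat.Coprimality using (prime⇒coprime; coprime-Bézout)
open import Data.Nat.GCD using (module Bézout)
open import Data.Fin using (Fin; zero; suc; toℕ)
open import Data.Fin.Properties using (pigeonhole; toℕ<n; all?; _≟_)
open import Data.List using (List; []; _∷_)
open import Data.Product using (∃; _×_; _,_; proj₁; proj₂)
open import Data.Sum using (_⊎_; inj₁; inj₂)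
open import Function using (_∘_; id)
open import Relation.Binary using (Setoid; IsEquivalence; Decidable; _Preserves_⟶_)
open import Relation.Binary.PropositionalEquality as ≡ using (_≡_; _≗_; cong)
import Relation.Binary.Reasoning.Setoid as SetoidReasoning
open import Relation.Nullary using (¬_; Dec; yes; no)
open import Relation.Nullary.Decidable using (_×-dec_; map′; from-yes)

iter-+ : ∀ {A : Set} (f : A → A) a b x → iter f (a + b) x ≡ iter f a (iter f b x)
iter-+ f zero    b x = ≡.refl
iter-+ f (suc a) b x = cong f (iter-+ f a b x)

module _ {A : Set} (f : A → A) {p : ℕ} (period : ∀ x → iter f p x ≡ x) where
  open ≡.≡-Reasoning

  iter-*-period : ∀ k x → iter f (k * p) x ≡ x
  iter-*-period zero    x = ≡.refl
  iter-*-period (suc k) x = begin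
    iter f (p + k * p) x         ≡⟨ iter-+ f p (k * p) x ⟩
    iter f p (iter f (k * p) x)  ≡⟨ cong (iter f p) (iter-*-period k x) ⟩
    iter f p x                   ≡⟨ period x ⟩
    x                            ∎

  iter-complement : ∀ i {o} → i + o ≡ p → ∀ x → iter f o (iter f i x) ≡ x
  iter-complement i {o} i+o≡p x = begin
    iter f o (iter f i x)  ≡⟨ iter-+ f o i x ⟨
    iter f (o + i) x       ≡⟨ cong (λ k → iter f k x) (≡.trans (+-comm o i) i+o≡p) ⟩
    iter f p x             ≡⟨ period x ⟩
    x                      ∎

module PeriodicAction {ℓ} (S : Setoid 0ℓ ℓ) (f : Setoid.Carrier S → Setoid.Carrier S)
                      (f-cong : f Preserves Setoid._≈_ S ⟶ Setoid._≈_ S) where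

  open Setoid S
  open SetoidReasoning S

  iter-cong : ∀ k {x y} → x ≈ y → iter f k x ≈ iter f k y
  iter-cong zero    x≈y = x≈y
  iter-cong (suc k) x≈y = f-cong (iter-cong k x≈y)

  ≈-iter-multiple : ∀ {d x} → x ≈ iter f d x → ∀ k → x ≈ iter f (k * d) x
  ≈-iter-multiple         x≈fᵈx zero    = refl
  ≈-iter-multiple {d} {x} x≈fᵈx (suc k) = begin
    x                            ≈⟨ x≈fᵈx ⟩
    iter f d x                   ≈⟨ iter-cong d (≈-iter-multiple x≈fᵈx k) ⟩
    iter f d (iter f (k * d) x)  ≡⟨ iter-+ f d (k * d) x ⟨
    iter f (d + k * d) x         ∎

  module _ {p} (p-prime : Prime p) (period : ∀ x → iter f p x ≡ x) where

    iter-cancel : ∀ {i x y} → i ≤ p → iter f i x ≈ iter f i y → x ≈ y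
    iter-cancel {i} {x} {y} i≤p fⁱx≈fⁱy with o , i+o≡p ← m≤n⇒∃[o]m+o≡n i≤p = begin
      x                      ≡⟨ iter-complement f period i i+o≡p x ⟨
      iter f o (iter f i x)  ≈⟨ iter-cong o fⁱx≈fⁱy ⟩
      iter f o (iter f i y)  ≡⟨ iter-complement f period i i+o≡p y ⟩
      y                      ∎

    -- Bézout: some multiple of suc d is ±1 modulo p.
    ≈-iter⇒≈-f : ∀ {d x} → suc d < p → x ≈ iter f (suc d) x → x ≈ f x
    ≈-iter⇒≈-f {d} {x} 1+d<p x≈fᵈx with coprime-Bézout (prime⇒coprime p-prime 1+d<p)
    ... | Bézout.-+ a b 1+ap≡bd = begin
      x                          ≈⟨ ≈-iter-multiple x≈fᵈx b ⟩
      iter f (b * suc d) x       ≡⟨ cong (λ k → iter f k x) 1+ap≡bd ⟨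
      f (iter f (a * p) x)       ≡⟨ cong f (iter-*-period f period a x) ⟩
      f x                        ∎
    ... | Bézout.+- a b 1+bd≡ap = sym (begin
      f x                        ≈⟨ f-cong (≈-iter-multiple x≈fᵈx b) ⟩
      iter f (1 + b * suc d) x   ≡⟨ cong (λ k → iter f k x) 1+bd≡ap ⟩
      iter f (a * p) x           ≡⟨ iter-*-period f period a x ⟩
      x                          ∎)

    ≈-f-of-fewer-classes : ∀ {m} → m < p → (rep : Fin m → Carrier) →
                           (∀ y → ∃ λ k → rep k ≈ y) → ∀ x → x ≈ f x
    ≈-f-of-fewer-classes m<p rep covers x
      with i , j , i<j , same-class ← pigeonhole m<p (λ j → proj₁ (covers (iter f (toℕ j) x)))
      with o , 1+i+o≡j ← m≤n⇒∃[o]m+o≡n i<j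
      = ≈-iter⇒≈-f 1+o<p (iter-cancel (<⇒≤ (toℕ<n i)) fⁱx≈fⁱ⁺ᵒ⁺¹x)
      where
      orbit : Fin p → Carrier
      orbit j = iter f (toℕ j) x

      i+1+o≡j : toℕ i + suc o ≡ toℕ j
      i+1+o≡j = ≡.trans (+-suc (toℕ i) o) 1+i+o≡j

      1+o<p : suc o < p
      1+o<p = ≤-<-trans (≤-trans (m≤n+m (suc o) (toℕ i)) (≤-reflexive i+1+o≡j)) (toℕ<n j)

      fⁱx≈fⁱ⁺ᵒ⁺¹x : iter f (toℕ i) x ≈ iter f (toℕ i) (iter f (suc o) x)
      fⁱx≈fⁱ⁺ᵒ⁺¹x = begin
        orbit i                          ≈⟨ proj₂ (covers (orbit i)) ⟨
        rep (proj₁ (covers (orbit i)))   ≡⟨ cong rep same-class ⟩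
        rep (proj₁ (covers (orbit j)))   ≈⟨ proj₂ (covers (orbit j)) ⟩
        orbit j                          ≡⟨ cong (λ k → iter f k x) i+1+o≡j ⟨
        iter f (toℕ i + suc o) x         ≡⟨ iter-+ f (toℕ i) (suc o) x ⟩
        iter f (toℕ i) (iter f (suc o) x) ∎

module Automorphisms {n : ℕ} (M : Map n) where

  act : List (Fin 3) → Fin n → Fin n
  act = actWord (r0 M) (r1 M) (r2 M)

  idᴬ : Aut M
  idᴬ = record { σ = id ; σ⁻¹ = id ; left = λ _ → ≡.refl ; right = λ _ → ≡.refl
               ; comm0 = λ _ → ≡.refl ; comm1 = λ _ → ≡.refl ; comm2 = λ _ → ≡.refl }

  _⁻¹ᴬ : Aut M → Aut M
  α ⁻¹ᴬ = record { σ = σ⁻¹ α ; σ⁻¹ = σ α ; left = right α ; right = left α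
                 ; comm0 = commutes⁻¹ (comm0 α) ; comm1 = commutes⁻¹ (comm1 α)
                 ; comm2 = commutes⁻¹ (comm2 α) }
    where
    commutes⁻¹ : ∀ {r} → (∀ x → σ α (r x) ≡ r (σ α x)) → ∀ x → σ⁻¹ α (r x) ≡ r (σ⁻¹ α x)
    commutes⁻¹ {r} comm x = begin
      σ⁻¹ α (r x)                  ≡⟨ cong (σ⁻¹ α ∘ r) (right α x) ⟨
      σ⁻¹ α (r (σ α (σ⁻¹ α x)))   ≡⟨ cong (σ⁻¹ α) (comm (σ⁻¹ α x)) ⟨
      σ⁻¹ α (σ α (r (σ⁻¹ α x)))   ≡⟨ left α (r (σ⁻¹ α x)) ⟩
      r (σ⁻¹ α x)                  ∎
      where open ≡.≡-Reasoning

  _∘ᴬ_ : Aut M → Aut M → Aut M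
  α ∘ᴬ β = record { σ = σ α ∘ σ β ; σ⁻¹ = σ⁻¹ β ∘ σ⁻¹ α
                  ; left  = λ x → ≡.trans (cong (σ⁻¹ β) (left α (σ β x))) (left β x)
                  ; right = λ x → ≡.trans (cong (σ α) (right β (σ⁻¹ α x))) (right α x)
                  ; comm0 = λ x → ≡.trans (cong (σ α) (comm0 β x)) (comm0 α (σ β x))
                  ; comm1 = λ x → ≡.trans (cong (σ α) (comm1 β x)) (comm1 α (σ β x))
                  ; comm2 = λ x → ≡.trans (cong (σ α) (comm2 β x)) (comm2 α (σ β x)) }

  σ-act : ∀ (α : Aut M) w x → σ α (act w x) ≡ act w (σ α x)
  σ-act α []                   x = ≡.refl
  σ-act α (zero ∷ w)           x = ≡.trans (comm0 α _) (cong (r0 M) (σ-act α w x))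
  σ-act α (suc zero ∷ w)       x = ≡.trans (comm1 α _) (cong (r1 M) (σ-act α w x))
  σ-act α (suc (suc zero) ∷ w) x = ≡.trans (comm2 α _) (cong (r2 M) (σ-act α w x))

  σ-actV : ∀ (α : Aut M) w x → σ α (actV M w x) ≡ actV M w (σ α x)
  σ-actV α []             x = ≡.refl
  σ-actV α (zero ∷ w)     x = ≡.trans (comm1 α _) (cong (r1 M) (σ-actV α w x))
  σ-actV α (suc zero ∷ w) x = ≡.trans (comm2 α _) (cong (r2 M) (σ-actV α w x))

  infix 4 _~_
  _~_ : Fin n → Fin n → Set
  _~_ = SameOrbit M

  ~-isEquivalence : IsEquivalence _~_
  ~-isEquivalence = record
    { refl  = idᴬ , ≡.refl
    ; sym   = λ { {x} (α , αx≡y) → α ⁻¹ᴬ , ≡.trans (cong (σ⁻¹ α) (≡.sym αx≡y)) (left α x) }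
    ; trans = λ { (α , αx≡y) (β , βy≡z) → β ∘ᴬ α , ≡.trans (cong (σ β) αx≡y) βy≡z }
    }

  orbitSetoid : Setoid 0ℓ 0ℓ
  orbitSetoid = record { isEquivalence = ~-isEquivalence }

  open IsEquivalence ~-isEquivalence public
    renaming (refl to ~-refl; sym to ~-sym; trans to ~-trans; reflexive to ~-reflexive)

  r0-cong : ∀ {x y} → x ~ y → r0 M x ~ r0 M y
  r0-cong {x} (α , αx≡y) = α , ≡.trans (comm0 α x) (cong (r0 M) αx≡y)

  r1-cong : ∀ {x y} → x ~ y → r1 M x ~ r1 M y
  r1-cong {x} (α , αx≡y) = α , ≡.trans (comm1 α x) (cong (r1 M) αx≡y)

  r2-cong : ∀ {x y} → x ~ y → r2 M x ~ r2 M y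
  r2-cong {x} (α , αx≡y) = α , ≡.trans (comm2 α x) (cong (r2 M) αx≡y)

  -- By connectedness an automorphism is determined by the image of a single flag,
  -- so x ~ y holds iff this candidate is an automorphism mapping x to y.
  transport : Fin n → Fin n → Fin n → Fin n
  transport x y z = act (proj₁ (connected M x z)) y

  σ≗transport : ∀ (α : Aut M) {x y} → σ α x ≡ y → σ α ≗ transport x y
  σ≗transport α {x} {y} αx≡y z with w , wx≡z ← connected M x z = begin
    σ α z          ≡⟨ cong (σ α) wx≡z ⟨
    σ α (act w x)  ≡⟨ σ-act α w x ⟩
    act w (σ α x)  ≡⟨ cong (act w) αx≡y ⟩
    act w y        ∎
    where open ≡.≡-Reasoning

  TransportIsAut : Fin n → Fin n → Set
  TransportIsAut x y =
    (t ∘ s ≗ id) × (s ∘ t ≗ id) ×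
    (s ∘ r0 M ≗ r0 M ∘ s) × (s ∘ r1 M ≗ r1 M ∘ s) × (s ∘ r2 M ≗ r2 M ∘ s) × s x ≡ y
    where
    s = transport x y
    t = transport y x

  infix 4 _≗?_
  _≗?_ : (f g : Fin n → Fin n) → Dec (f ≗ g)
  f ≗? g = all? λ z → f z ≟ g z

  transportIsAut? : ∀ x y → Dec (TransportIsAut x y)
  transportIsAut? x y =
    (t ∘ s ≗? id) ×-dec (s ∘ t ≗? id) ×-dec
    (s ∘ r0 M ≗? r0 M ∘ s) ×-dec (s ∘ r1 M ≗? r1 M ∘ s) ×-dec (s ∘ r2 M ≗? r2 M ∘ s) ×-dec
    (s x ≟ y)
    where
    s = transport x y
    t = transport y x

  transportIsAut⇒~ : ∀ {x y} → TransportIsAut x y → x ~ y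
  transportIsAut⇒~ {x} {y} (left , right , comm0 , comm1 , comm2 , sx≡y) =
    record { σ = transport x y ; σ⁻¹ = transport y x
           ; left = left ; right = right ; comm0 = comm0 ; comm1 = comm1 ; comm2 = comm2 } , sx≡y

  ~⇒transportIsAut : ∀ {x y} → x ~ y → TransportIsAut x y
  ~⇒transportIsAut {x} {y} (α , αx≡y) =
      (λ z → ≡.trans (t≗σ⁻¹ (s z)) (≡.trans (cong (σ⁻¹ α) (s≗σ z)) (left α z)))
    , (λ z → ≡.trans (s≗σ (t z)) (≡.trans (cong (σ α) (t≗σ⁻¹ z)) (right α z)))
    , commutes (comm0 α) , commutes (comm1 α) , commutes (comm2 α)
    , ≡.trans (s≗σ x) αx≡y
    where
    s = transport x y
    t = transport y x
    s≗σ : s ≗ σ α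
    s≗σ z = ≡.sym (σ≗transport α αx≡y z)
    t≗σ⁻¹ : t ≗ σ⁻¹ α
    t≗σ⁻¹ z = ≡.sym (σ≗transport (α ⁻¹ᴬ) (proj₂ (~-sym (α , αx≡y))) z)
    commutes : ∀ {r} → (∀ z → σ α (r z) ≡ r (σ α z)) → s ∘ r ≗ r ∘ s
    commutes {r} comm z = ≡.trans (s≗σ (r z)) (≡.trans (comm z) (cong r (≡.sym (s≗σ z))))

  _~?_ : Decidable _~_
  x ~? y = map′ transportIsAut⇒~ ~⇒transportIsAut (transportIsAut? x y)

module TwoFlagOrbits {n : ℕ} (M : Map n) (r1~r0 : ∀ x → SameOrbit M (r1 M x) (r0 M x))
                     (r2~r0 : ∀ x → SameOrbit M (r2 M x) (r0 M x)) where

  open Automorphisms M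

  act-∷ : ∀ g w x → act (g ∷ w) x ~ r0 M (act w x)
  act-∷ zero             w x = ~-refl
  act-∷ (suc zero)       w x = r1~r0 (act w x)
  act-∷ (suc (suc zero)) w x = r2~r0 (act w x)

  act~⊎act~r0 : ∀ w x → act w x ~ x ⊎ act w x ~ r0 M x
  act~⊎act~r0 []      x = inj₁ ~-refl
  act~⊎act~r0 (g ∷ w) x with act~⊎act~r0 w x
  ... | inj₁ wx~x   = inj₂ (~-trans (act-∷ g w x) (r0-cong wx~x))
  ... | inj₂ wx~r0x = inj₁ (~-trans (act-∷ g w x) (~-trans (r0-cong wx~r0x) (~-reflexive (r0-inv M x))))

  ~⊎r0~ : ∀ x y → x ~ y ⊎ r0 M x ~ y
  ~⊎r0~ x y with w , wx≡y ← connected M x y with act~⊎act~r0 w x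
  ... | inj₁ wx~x   = inj₁ (~-trans (~-sym wx~x) (~-reflexive wx≡y))
  ... | inj₂ wx~r0x = inj₂ (~-trans (~-sym wx~r0x) (~-reflexive wx≡y))

  ~r0-transfer : ∀ {x} y → x ~ r0 M x → y ~ r0 M y
  ~r0-transfer {x} y x~r0x with ~⊎r0~ x y
  ... | inj₁ x~y   = ~-trans (~-sym x~y) (~-trans x~r0x (r0-cong x~y))
  ... | inj₂ r0x~y = ~-trans (~-sym r0x~y)
                       (~-trans (~-sym x~r0x) (~-trans (~-reflexive (≡.sym (r0-inv M x))) (r0-cong r0x~y)))

  regular⊎chiral-from : Fin n → Regular M ⊎ Chiral M
  regular⊎chiral-from x₀ with x₀ ~? r0 M x₀
  ... | yes x₀~r0x₀ = inj₁ λ x y → ~-trans (~-sym (x₀~ x)) (x₀~ y)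
    where
    x₀~ : ∀ y → x₀ ~ y
    x₀~ y with ~⊎r0~ x₀ y
    ... | inj₁ x₀~y   = x₀~y
    ... | inj₂ r0x₀~y = ~-trans x₀~r0x₀ r0x₀~y
  ... | no x₀≁r0x₀ =
    inj₂ ( (x₀ , r0 M x₀ , x₀≁r0x₀ , ~⊎r0~ x₀)
         , λ x → x≁r0x x , x≁r0x x ∘ (λ x~r1x → ~-trans x~r1x (r1~r0 x))
                         , x≁r0x x ∘ (λ x~r2x → ~-trans x~r2x (r2~r0 x)) )
    where
    x≁r0x : ∀ x → ¬ x ~ r0 M x
    x≁r0x x = x₀≁r0x₀ ∘ ~r0-transfer x₀

regular⊎chiral : ∀ {n} (M : Map n) →
                 (∀ x → SameOrbit M (r1 M x) (r0 M x)) → (∀ x → SameOrbit M (r2 M x) (r0 M x)) →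
                 Regular M ⊎ Chiral M
regular⊎chiral {zero}  M r1~r0 r2~r0 = inj₁ λ ()
regular⊎chiral {suc _} M r1~r0 r2~r0 = TwoFlagOrbits.regular⊎chiral-from M r1~r0 r2~r0 zero

module SchläfliSevenThree {n : ℕ} (M : Map n) (type : SchlafliType M 7 3) where
  open Automorphisms M

  faceRotation : Fin n → Fin n
  faceRotation x = r0 M (r1 M x)

  faceRotation-period : ∀ x → iter faceRotation 7 x ≡ x
  faceRotation-period x = proj₁ (proj₂ (proj₁ type x))

  vertexRotation : Fin n → Fin n
  vertexRotation x = r1 M (r2 M x)

  vertexRotation-order : ∀ x → vertexRotation (vertexRotation (vertexRotation x)) ≡ x
  vertexRotation-order x = proj₁ (proj₂ (proj₂ type x))

  aba : Fin n → Fin n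
  aba x = r1 M (r2 M (r1 M x))

  aba-involutive : ∀ x → aba (aba x) ≡ x
  aba-involutive x = begin
    r1 M (r2 M (r1 M (r1 M (r2 M (r1 M x)))))  ≡⟨ cong (r1 M ∘ r2 M) (r1-inv M (r2 M (r1 M x))) ⟩
    r1 M (r2 M (r2 M (r1 M x)))                ≡⟨ cong (r1 M) (r2-inv M (r1 M x)) ⟩
    r1 M (r1 M x)                              ≡⟨ r1-inv M x ⟩
    x                                          ∎
    where open ≡.≡-Reasoning

  braid : ∀ x → r2 M (r1 M (r2 M x)) ≡ aba x
  braid x = begin
    r2 M (r1 M (r2 M x))              ≡⟨ aba-involutive (r2 M (r1 M (r2 M x))) ⟨
    aba (aba (r2 M (r1 M (r2 M x))))  ≡⟨ cong aba (vertexRotation-order x) ⟩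
    aba x                             ∎
    where open ≡.≡-Reasoning

  -- The vertex stabiliser ⟨r1, r2⟩ of the monodromy group is dihedral of order 6;
  -- its elements as reduced words in a = r1, b = r2.
  pattern ε′   = zero
  pattern a′   = suc zero
  pattern b′   = suc (suc zero)
  pattern ab′  = suc (suc (suc zero))
  pattern ba′  = suc (suc (suc (suc zero)))
  pattern aba′ = suc (suc (suc (suc (suc zero))))

  vertexFlag : Fin 6 → Fin n → Fin n
  vertexFlag ε′   x = x
  vertexFlag a′   x = r1 M x
  vertexFlag b′   x = r2 M x
  vertexFlag ab′  x = r1 M (r2 M x)
  vertexFlag ba′  x = r2 M (r1 M x)
  vertexFlag aba′ x = aba x

  a· b· : Fin 6 → Fin 6
  a· ε′   = a′
  a· a′   = ε′
  a· b′   = ab′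
  a· ab′  = b′
  a· ba′  = aba′
  a· aba′ = ba′
  b· ε′   = b′
  b· a′   = ba′
  b· b′   = ε′
  b· ab′  = aba′
  b· ba′  = a′
  b· aba′ = ab′

  vertexFlag-a· : ∀ k x → vertexFlag (a· k) x ≡ r1 M (vertexFlag k x)
  vertexFlag-a· ε′   x = ≡.refl
  vertexFlag-a· a′   x = ≡.sym (r1-inv M x)
  vertexFlag-a· b′   x = ≡.refl
  vertexFlag-a· ab′  x = ≡.sym (r1-inv M (r2 M x))
  vertexFlag-a· ba′  x = ≡.refl
  vertexFlag-a· aba′ x = ≡.sym (r1-inv M (r2 M (r1 M x)))

  vertexFlag-b· : ∀ k x → vertexFlag (b· k) x ≡ r2 M (vertexFlag k x)
  vertexFlag-b· ε′   x = ≡.refl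
  vertexFlag-b· a′   x = ≡.refl
  vertexFlag-b· b′   x = ≡.sym (r2-inv M x)
  vertexFlag-b· ab′  x = ≡.sym (braid x)
  vertexFlag-b· ba′  x = ≡.sym (r2-inv M (r1 M x))
  vertexFlag-b· aba′ x = ≡.sym (≡.trans (braid (r1 M x)) (cong (r1 M ∘ r2 M) (r1-inv M x)))

  reduce : List (Fin 2) → Fin 6
  reduce []             = ε′
  reduce (zero ∷ w)     = a· (reduce w)
  reduce (suc zero ∷ w) = b· (reduce w)

  actV≡vertexFlag : ∀ w x → actV M w x ≡ vertexFlag (reduce w) x
  actV≡vertexFlag []             x = ≡.refl
  actV≡vertexFlag (zero ∷ w)     x =
    ≡.trans (cong (r1 M) (actV≡vertexFlag w x)) (≡.sym (vertexFlag-a· (reduce w) x))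
  actV≡vertexFlag (suc zero ∷ w) x =
    ≡.trans (cong (r2 M) (actV≡vertexFlag w x)) (≡.sym (vertexFlag-b· (reduce w) x))

  module _ (vt : VertexTransitive M) where

    vertexFlag~ : ∀ x y → ∃ λ k → vertexFlag k x ~ y
    vertexFlag~ x y with α , w , wαx≡y ← vt x y = reduce w , α , (begin
      σ α (vertexFlag (reduce w) x)  ≡⟨ cong (σ α) (actV≡vertexFlag w x) ⟨
      σ α (actV M w x)               ≡⟨ σ-actV α w x ⟩
      actV M w (σ α x)               ≡⟨ wαx≡y ⟩
      y                              ∎)
      where open ≡.≡-Reasoning

    x~faceRotation : ∀ x → x ~ faceRotation x
    x~faceRotation x =
      PeriodicAction.≈-f-of-fewer-classes orbitSetoid faceRotation (r0-cong ∘ r1-cong)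
        (from-yes (prime? 7)) faceRotation-period ≤-refl (λ k → vertexFlag k x) (vertexFlag~ x) x

    r1~r0 : ∀ x → r1 M x ~ r0 M x
    r1~r0 x = ~-trans (x~faceRotation (r1 M x)) (~-reflexive (cong (r0 M) (r1-inv M x)))

    r1r2~r2r1 : ∀ x → r1 M (r2 M x) ~ r2 M (r1 M x)
    r1r2~r2r1 x =
      ~-trans (r1~r0 (r2 M x)) (~-trans (~-reflexive (r0r2-comm M x)) (r2-cong (~-sym (r1~r0 x))))

    vertexRotation²~ : ∀ x → vertexRotation (vertexRotation x) ~ x
    vertexRotation²~ x = ~-trans (r1-cong (r2-cong (r1r2~r2r1 x)))
                                 (~-reflexive (≡.trans (cong (r1 M) (r2-inv M (r1 M x))) (r1-inv M x)))

    vertexRotation~ : ∀ x → vertexRotation x ~ x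
    vertexRotation~ x =
      ~-trans (~-sym (vertexRotation²~ (vertexRotation x))) (~-reflexive (vertexRotation-order x))

    r2~r0 : ∀ x → r2 M x ~ r0 M x
    r2~r0 x =
      ~-trans (~-reflexive (≡.sym (r1-inv M (r2 M x)))) (~-trans (r1-cong (vertexRotation~ x)) (r1~r0 x))

mainTheorem4 : (n : ℕ) (M : Map n) → VertexTransitive M → SchlafliType M 7 3 → Regular M ⊎ Chiral M
mainTheorem4 n M vt type = regular⊎chiral M (r1~r0 vt) (r2~r0 vt)
  where open SchläfliSevenThree M type
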